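{- Let $l\in\mathbb{N}$ and let $(r_n)_{n=1}^l$ be any sequence produced by the following greedy procedure: $r_1=(1)$; for $2\le n\le l$, let $r'_n\in\mathbb{N}_0^n$ be $r_{n-1}$ with a $0$ appended at the end, and let $R_n$ be the set of vectors obtained from $r'_n$ by increasing its $i$th entry by $1$, for each index $1\le i\le n$ satisfying one of: (a) $i=n$ and $r'_n[n]\ne r'_n[n-1]$; (b) $1<i<n$, $r'_n[i]\ne r'_n[i-1]$ and $r'_n[i]=r'_n[i+1]$; (c) $i=1$ and $r'_n[1]=r'_n[2]$; then $r_n$ is an element of $R_n$ maximizing the coefficient $c_{r_n}$ (the coefficient of $x_1^{r_n[1]}\cdots x_n^{r_n[n]}$ in $p_n$). Then $R_n$ is nonempty for every $2\le n\le l$ and $r_n\in\mathcal{M}_n$ for every $1\le n\le l$.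
   Context: For $n\in\mathbb{N}$ and indeterminates $x_1,\ldots,x_n$, let $p_n=x_1(x_1+x_2)\cdots(x_1+x_2+\cdots+x_n)$, and for a vector $a\in\mathbb{N}_0^n$ let $c_a$ be the coefficient of $x_1^{a_1}\cdots x_n^{a_n}$ in the expansion of $p_n$. Let $\mathbb{N}_0=\mathbb{N}\cup\{0\}$, $\mathcal{A}_n=\{(a_1,\ldots,a_n)\in\mathbb{N}_0^n : \sum_{i=k+1}^n a_i\le n-k \text{ for all } 1\le k\le n-1,\ \sum_{i=1}^n a_i=n\}$, and $\mathcal{M}_n=\{(a_1,\ldots,a_n)\in\mathcal{A}_n : a_{i+1}\le a_i\le a_{i+1}+1 \text{ for all } 1\le i\le n-1\}$. For a vector $v$, $v[i]$ denotes its $i$th entry. -}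

module Defs where

open import Data.Nat using (ℕ; zero; suc; _+_; _∸_; _≤_; _<_; _<ᵇ_; _≡ᵇ_; pred)
open import Data.Bool using (Bool; true; false; if_then_else_; _∧_; not)
open import Data.Fin using (Fin; toℕ)
open import Data.Vec using (Vec; []; _∷_; lookup; toList; _[_]%=_; _∷ʳ_)
open import Data.List using (List; map; drop; allFin)
open import Data.Nat.ListAction using (sum)
open import Data.Sum using (_⊎_)
open import Data.Product using (Σ; ∃; _×_)
open import Relation.Binary.PropositionalEquality using (_≡_)
open import Relation.Nullary using (¬_)

-- entry at 0-based position j (0 if out of range); a[j+1] in the paper's 1-based notation
at : {n : ℕ} → Vec ℕ n → ℕ → ℕ
at []       _       = 0
at (x ∷ xs) zero    = x
at (x ∷ xs) (suc j) = at xs j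

-- coef k a : coefficient of x_1^{a[1]} ⋯ x_n^{a[n]} in
--   p_k = x_1 (x_1 + x_2) ⋯ (x_1 + ⋯ + x_k)   (k ≤ n intended),
-- computed by expanding p_{k+1} = p_k · (x_1 + ⋯ + x_{k+1}):
--   [x^a] p_{k+1} = Σ_{i ≤ k+1, a_i ≥ 1} [x^{a - e_i}] p_k ,   [x^a] p_0 = [a = 0].
coef : {n : ℕ} → ℕ → Vec ℕ n → ℕ
coef {n} zero    a = if sum (toList a) ≡ᵇ 0 then 1 else 0
coef {n} (suc k) a = sum (map term (allFin n))
  where
  term : Fin n → ℕ
  term i = if (toℕ i <ᵇ suc k) ∧ not (lookup a i ≡ᵇ 0)
           then coef k (a [ i ]%= pred) else 0

c : {n : ℕ} → Vec ℕ n → ℕ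
c {n} a = coef n a

InA : (n : ℕ) → Vec ℕ n → Set
InA n a = ((k : ℕ) → 1 ≤ k → k ≤ n ∸ 1 → sum (drop k (toList a)) ≤ n ∸ k)
        × sum (toList a) ≡ n

-- ℳ_n  (0-based j = i - 1, for 1 ≤ i ≤ n-1)
InM : (n : ℕ) → Vec ℕ n → Set
InM n a = InA n a
        × ((j : ℕ) → suc j ≤ n ∸ 1 → at a (suc j) ≤ at a j × at a j ≤ at a (suc j) + 1)

-- admissible index (0-based j = i - 1) for r' ∈ ℕ₀^n
Admissible : {n : ℕ} → Vec ℕ n → Fin n → Set
Admissible {n} r' i =
    (suc j ≡ n × ¬ (at r' j ≡ at r' (j ∸ 1)))
  ⊎ ((1 ≤ j × suc j < n) × ¬ (at r' j ≡ at r' (j ∸ 1)) × at r' j ≡ at r' (suc j))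
  ⊎ (j ≡ 0 × at r' 0 ≡ at r' 1)
  where
  j = toℕ i

InR : {m : ℕ} → Vec ℕ m → Vec ℕ (suc m) → Set
InR r v = ∃ λ i → Admissible (r ∷ʳ 0) i × v ≡ ((r ∷ʳ 0) [ i ]%= suc)

GreedyStep : {m : ℕ} → Vec ℕ m → Vec ℕ (suc m) → Set
GreedyStep r s = InR r s × ((w : Vec ℕ _) → InR r w → c w ≤ c s)

-- Appending 0 to a vector of 𝒜ₙ₋₁ and raising any one entry by 1 gives a vector
-- of 𝒜ₙ, because the last entry of a vector in 𝒜ₙ₋₁ is at most 1.  The
-- admissibility conditions (a)–(c) say precisely that the raised entry is
-- strictly below its left neighbour and equal to its right one, which is what
-- keeps the staircase a[i+1] ≤ a[i] ≤ a[i+1] + 1 intact.  Rₙ is nonempty: if the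
-- appended 0 differs from its left neighbour, (a) applies; otherwise the first
-- entry of the block of equal entries ending in that 0 is admissible by (b) or
-- (c).
module Submission where

open import Defs
open import Data.Nat using (ℕ; zero; suc; _≤_; _<_; _+_; _∸_; z≤n; s≤s)
open import Data.Nat.Properties
open import Data.Vec using (Vec; []; _∷_; toList; _[_]%=_; _∷ʳ_)
open import Data.List using (drop)
open import Data.Nat.ListAction using (sum)
open import Data.Fin using (Fin; toℕ; fromℕ<)
open import Data.Fin.Properties using (toℕ-fromℕ<)
open import Data.Product using (∃; _×_; _,_; proj₁; proj₂)
open import Data.Sum using (_⊎_; inj₁; inj₂)
open import Data.Empty using (⊥-elim)
open import Relation.Nullary using (yes; no)
open import Relation.Binary.PropositionalEquality
open import Function using (_∘_)

Staircase : (ℕ → ℕ) → ℕ → Set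
Staircase a m = ∀ j → suc j ≤ m → a (suc j) ≤ a j × a j ≤ a (suc j) + 1

staircase-bump : ∀ {a b : ℕ → ℕ} {t m} → Staircase a m
               → b t ≡ suc (a t) → (∀ j → j ≢ t → b j ≡ a j)
               → (1 ≤ t → a t ≢ a (t ∸ 1)) → (suc t ≤ m → a t ≡ a (suc t))
               → Staircase b m
staircase-bump {a} {b} {t} st bt b≡a left right j j<m with j ≟ t | suc j ≟ t
... | yes refl | _
  rewrite bt | b≡a (suc j) 1+n≢n
  = m≤n⇒m≤1+n (proj₁ (st j j<m))
  , ≤-reflexive (trans (cong suc (right j<m)) (+-comm 1 _))
... | no j≢t | yes refl
  rewrite bt | b≡a j j≢t
  = ≤∧≢⇒< (proj₁ (st j j<m)) (left (s≤s z≤n))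
  , ≤-trans (proj₂ (st j j<m)) (+-monoˡ-≤ 1 (n≤1+n _))
... | no j≢t | no sj≢t
  rewrite b≡a j j≢t | b≡a (suc j) sj≢t
  = st j j<m

staircase-extend : ∀ {a : ℕ → ℕ} {m} → Staircase a m
                 → a m ≤ 1 → a (suc m) ≡ 0 → Staircase a (suc m)
staircase-extend {m = m} st am≤1 am+1≡0 j j≤m with j ≟ m
... | yes refl rewrite am+1≡0 = z≤n , am≤1
... | no j≢m = st j (≤∧≢⇒< (≤-pred j≤m) j≢m)

run-start : (a : ℕ → ℕ) (k : ℕ) → a k ≡ a (suc k)
          → ∃ λ j → j ≤ k × a j ≡ a (suc j) × (j ≡ 0 ⊎ a j ≢ a (j ∸ 1))
run-start a zero eq = 0 , z≤n , eq , inj₁ refl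
run-start a (suc k) eq with a k ≟ a (suc k)
... | yes eq′ = let (j , j≤k , rest) = run-start a k eq′ in j , m≤n⇒m≤1+n j≤k , rest
... | no neq = suc k , ≤-refl , eq , inj₂ (≢-sym neq)

at-∷ʳ0 : ∀ {n} (r : Vec ℕ n) j → at (r ∷ʳ 0) j ≡ at r j
at-∷ʳ0 []      zero    = refl
at-∷ʳ0 []      (suc j) = refl
at-∷ʳ0 (x ∷ r) zero    = refl
at-∷ʳ0 (x ∷ r) (suc j) = at-∷ʳ0 r j

at-last-∷ʳ0 : ∀ {n} (r : Vec ℕ n) → at (r ∷ʳ 0) n ≡ 0
at-last-∷ʳ0 []      = refl
at-last-∷ʳ0 (x ∷ r) = at-last-∷ʳ0 r

at-%=suc-self : ∀ {n} (v : Vec ℕ n) (i : Fin n) → at (v [ i ]%= suc) (toℕ i) ≡ suc (at v (toℕ i))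
at-%=suc-self (x ∷ v) Fin.zero    = refl
at-%=suc-self (x ∷ v) (Fin.suc i) = at-%=suc-self v i

at-%=suc-other : ∀ {n} (v : Vec ℕ n) (i : Fin n) j → j ≢ toℕ i → at (v [ i ]%= suc) j ≡ at v j
at-%=suc-other (x ∷ v) Fin.zero    zero    j≢i = ⊥-elim (j≢i refl)
at-%=suc-other (x ∷ v) Fin.zero    (suc j) j≢i = refl
at-%=suc-other (x ∷ v) (Fin.suc i) zero    j≢i = refl
at-%=suc-other (x ∷ v) (Fin.suc i) (suc j) j≢i = at-%=suc-other v i j (j≢i ∘ cong suc)

at-%=suc-≤ : ∀ {n} (v : Vec ℕ n) (i : Fin n) j → at (v [ i ]%= suc) j ≤ suc (at v j)
at-%=suc-≤ (x ∷ v) Fin.zero    zero    = ≤-refl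
at-%=suc-≤ (x ∷ v) Fin.zero    (suc j) = n≤1+n _
at-%=suc-≤ (x ∷ v) (Fin.suc i) zero    = n≤1+n x
at-%=suc-≤ (x ∷ v) (Fin.suc i) (suc j) = at-%=suc-≤ v i j

sum-%=suc : ∀ {n} (v : Vec ℕ n) (i : Fin n) → sum (toList (v [ i ]%= suc)) ≡ suc (sum (toList v))
sum-%=suc (x ∷ v) Fin.zero    = refl
sum-%=suc (x ∷ v) (Fin.suc i) = trans (cong (x +_) (sum-%=suc v i)) (+-suc x _)

sum-drop-%=suc-≤ : ∀ {n} (v : Vec ℕ n) (i : Fin n) k
                 → sum (drop k (toList (v [ i ]%= suc))) ≤ suc (sum (drop k (toList v)))
sum-drop-%=suc-≤ v       i           zero    = ≤-reflexive (sum-%=suc v i)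
sum-drop-%=suc-≤ (x ∷ v) Fin.zero    (suc k) = n≤1+n _
sum-drop-%=suc-≤ (x ∷ v) (Fin.suc i) (suc k) = sum-drop-%=suc-≤ v i k

sum-drop-∷ʳ0 : ∀ {n} (r : Vec ℕ n) k → sum (drop k (toList (r ∷ʳ 0))) ≡ sum (drop k (toList r))
sum-drop-∷ʳ0 []      zero          = refl
sum-drop-∷ʳ0 []      (suc zero)    = refl
sum-drop-∷ʳ0 []      (suc (suc k)) = refl
sum-drop-∷ʳ0 (x ∷ r) zero          = cong (x +_) (sum-drop-∷ʳ0 r 0)
sum-drop-∷ʳ0 (x ∷ r) (suc k)       = sum-drop-∷ʳ0 r k

sum-drop-last : ∀ {n} (v : Vec ℕ (suc n)) → sum (drop n (toList v)) ≡ at v n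
sum-drop-last (x ∷ [])    = +-identityʳ x
sum-drop-last (x ∷ y ∷ v) = sum-drop-last (y ∷ v)

InA-last≤1 : ∀ {n} (a : Vec ℕ (suc n)) → InA (suc n) a → at a n ≤ 1
InA-last≤1 (x ∷ [])    (_ , total)  = ≤-reflexive (trans (sym (+-identityʳ x)) total)
InA-last≤1 {suc n} a   (suffix , _) = begin
  at a (suc n)                  ≡⟨ sum-drop-last a ⟨
  sum (drop (suc n) (toList a)) ≤⟨ suffix (suc n) (s≤s z≤n) ≤-refl ⟩
  suc (suc n) ∸ suc n           ≡⟨ m+n∸n≡m 1 (suc n) ⟩
  1                             ∎
  where open ≤-Reasoning

InA-bump : ∀ {m} (r : Vec ℕ (suc m)) (i : Fin (suc (suc m)))
         → InA (suc m) r → InA (suc (suc m)) ((r ∷ʳ 0) [ i ]%= suc)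
InA-bump {m} r i (suffix , total) = suffix′ , total′
  where
  open ≤-Reasoning
  r′ = r ∷ʳ 0
  v = r′ [ i ]%= suc

  total′ : sum (toList v) ≡ suc (suc m)
  total′ = trans (sum-%=suc r′ i) (cong suc (trans (sum-drop-∷ʳ0 r 0) total))

  suffix′ : ∀ k → 1 ≤ k → k ≤ suc m → sum (drop k (toList v)) ≤ suc (suc m) ∸ k
  suffix′ k 1≤k k≤m+1 with k ≟ suc m
  ... | yes refl = begin
    sum (drop (suc m) (toList v)) ≡⟨ sum-drop-last v ⟩
    at v (suc m)                  ≤⟨ at-%=suc-≤ r′ i (suc m) ⟩
    suc (at r′ (suc m))           ≡⟨ cong suc (at-last-∷ʳ0 r) ⟩
    1                             ≡⟨ m+n∸n≡m 1 (suc m) ⟨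
    suc (suc m) ∸ suc m           ∎
  ... | no k≢m+1 = begin
    sum (drop k (toList v))        ≤⟨ sum-drop-%=suc-≤ r′ i k ⟩
    suc (sum (drop k (toList r′))) ≡⟨ cong suc (sum-drop-∷ʳ0 r k) ⟩
    suc (sum (drop k (toList r)))  ≤⟨ s≤s (suffix k 1≤k (≤-pred (≤∧≢⇒< k≤m+1 k≢m+1))) ⟩
    suc (suc m ∸ k)                ≡⟨ +-∸-assoc 1 k≤m+1 ⟨
    suc (suc m) ∸ k                ∎

staircase-∷ʳ0 : ∀ {m} (r : Vec ℕ (suc m)) → Staircase (at r) m → at r m ≤ 1
              → Staircase (at (r ∷ʳ 0)) (suc m)
staircase-∷ʳ0 {m} r st last≤1 =
  staircase-extend st′ (subst (_≤ 1) (sym (at-∷ʳ0 r m)) last≤1) (at-last-∷ʳ0 r)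
  where
  st′ : Staircase (at (r ∷ʳ 0)) m
  st′ j j<m rewrite at-∷ʳ0 r j | at-∷ʳ0 r (suc j) = st j j<m

-- The body of Admissible with the index as a natural number, so that
-- Admissible r′ i is definitionally AdmissibleAt r′ (toℕ i).
AdmissibleAt : ∀ {n} → Vec ℕ n → ℕ → Set
AdmissibleAt {n} r′ j =
    (suc j ≡ n × at r′ j ≢ at r′ (j ∸ 1))
  ⊎ ((1 ≤ j × suc j < n) × at r′ j ≢ at r′ (j ∸ 1) × at r′ j ≡ at r′ (suc j))
  ⊎ (j ≡ 0 × at r′ 0 ≡ at r′ 1)

admissible-left : ∀ {n} {r′ : Vec ℕ n} {j} → AdmissibleAt r′ j → 1 ≤ j → at r′ j ≢ at r′ (j ∸ 1)
admissible-left (inj₁ (_ , neq))               _   = neq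
admissible-left (inj₂ (inj₁ (_ , neq , _)))    _   = neq
admissible-left (inj₂ (inj₂ (refl , _)))       ()

admissible-right : ∀ {n} {r′ : Vec ℕ n} {j} → AdmissibleAt r′ j → suc j < n → at r′ j ≡ at r′ (suc j)
admissible-right (inj₁ (refl , _))           j+1<n = ⊥-elim (<-irrefl refl j+1<n)
admissible-right (inj₂ (inj₁ (_ , _ , eq)))  _     = eq
admissible-right (inj₂ (inj₂ (refl , eq)))   _     = eq

InR-at : ∀ {m} (r : Vec ℕ m) {j} (j<n : j < suc m) → AdmissibleAt (r ∷ʳ 0) j → ∃ (InR r)
InR-at r j<n adm =
  _ , fromℕ< j<n , subst (AdmissibleAt (r ∷ʳ 0)) (sym (toℕ-fromℕ< j<n)) adm , refl

R-nonempty : ∀ {m} (r : Vec ℕ (suc m)) → ∃ (InR r)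
R-nonempty {m} r with at r′ m ≟ at r′ (suc m)
  where r′ = r ∷ʳ 0
... | no neq = InR-at r ≤-refl (inj₁ (refl , ≢-sym neq))
... | yes eq with run-start (at (r ∷ʳ 0)) m eq
...   | zero  , _   , eq₀ , _         = InR-at r (s≤s z≤n) (inj₂ (inj₂ (refl , eq₀)))
...   | suc j , _   , _   , inj₁ ()
...   | suc j , j<m , eqⱼ , inj₂ start =
  InR-at r (s≤s (m≤n⇒m≤1+n j<m)) (inj₂ (inj₁ ((s≤s z≤n , s≤s (s≤s j<m)) , start , eqⱼ)))

InM-step : ∀ {m} (r : Vec ℕ (suc m)) {s} → InM (suc m) r → InR r s → InM (suc (suc m)) s
InM-step r (inA , st) (i , adm , refl) =
    InA-bump r i inA
  , staircase-bump (staircase-∷ʳ0 r st (InA-last≤1 r inA))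
                   (at-%=suc-self r′ i) (at-%=suc-other r′ i)
                   (admissible-left {r′ = r′} adm) (admissible-right {r′ = r′} adm ∘ s≤s)
  where r′ = r ∷ʳ 0

InM-one : InM 1 (1 ∷ [])
InM-one = ((λ k 1≤k k≤0 → ⊥-elim (<-irrefl refl (≤-trans 1≤k k≤0))) , refl) , λ _ ()

lemma12 : (l : ℕ) → 1 ≤ l → (r : (n : ℕ) → Vec ℕ n)
        → r 1 ≡ 1 ∷ []
        → ((m : ℕ) → 1 ≤ m → suc m ≤ l → GreedyStep (r m) (r (suc m)))
        → ((m : ℕ) → 1 ≤ m → suc m ≤ l → ∃ λ v → InR (r m) v)
          × ((n : ℕ) → 1 ≤ n → n ≤ l → InM n (r n))
lemma12 l _ r r₁ greedy = (λ { (suc m) _ _ → R-nonempty (r (suc m)) }) , rows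
  where
  rows : (n : ℕ) → 1 ≤ n → n ≤ l → InM n (r n)
  rows (suc zero)    _ _   = subst (InM 1) (sym r₁) InM-one
  rows (suc (suc m)) _ n≤l =
    InM-step (r (suc m)) (rows (suc m) (s≤s z≤n) (≤-trans (n≤1+n _) n≤l))
             (proj₁ (greedy (suc m) (s≤s z≤n) n≤l))
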